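{- Let $\mathcal C_n$ be the set of permutations in $\mathfrak S_n$ avoiding $1\text{ - }23$, $3\text{ - }12$ and $34\text{ - }21$. Label each $\pi\in\mathcal C_n$ by $(s(\pi),\pi_n,n)$. Then $1\in\mathcal C_1$ has label $(0,1,1)$, and for $\pi\in\mathcal C_n$ with label $(s,r,n)$ the multiset of labels of its children in $\mathcal C_{n+1}$ is: $(s+1,1,n+1),\dots,(s+1,s,n+1),(s,s+1,n+1),(s,s+2,n+1),\dots,(s,r,n+1)$ if $s<r\neq1$; $(0,1,n+1),(1,n+1,n+1)$ if $(s,r)=(0,1)$; $(s,n+1,n+1)$ if $s>r=1$; and empty (no children) if $s>r>1$.
   Context: $\mathfrak S_n$ is the set of permutations $\pi=\pi_1\cdots\pi_n$ of $\{1,\dots,n\}$. $\pi$ avoids $1\text{ - }23$ if there are no $i<j$ with $\pi_i<\pi_j<\pi_{j+1}$; $\pi$ avoids $3\text{ - }12$ if there are no $i<j$ with $\pi_j<\pi_{j+1}<\pi_i$; $\pi$ avoids $34\text{ - }21$ if there are no $i$ and $k>i+1$ with $\pi_{k+1}<\pi_k<\pi_i<\pi_{i+1}$. For $\pi\in\mathfrak S_n$ and $j\in\{1,\dots,n+1\}$, appending $j$ to $\pi$ gives the permutation of $\{1,\dots,n+1\}$ whose first $n$ entries are $\pi_i$ if $\pi_i<j$ and $\pi_i+1$ if $\pi_i\ge j$, and whose last entry is $j$. The children of $\pi\in\mathcal C_n$ are the permutations obtained by appending some $j$ to $\pi$ that lie in $\mathcal C_{n+1}$. $s(\pi)=0$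 if $\pi=n(n-1)\cdots21$, and otherwise $s(\pi)=\max\{\pi_i:\pi_i<\pi_{i+1}\}$. -}

module Defs where

open import Data.Nat using (ℕ; zero; suc; _+_; _∸_; _<_; _≤_; _⊔_; _<?_; _≤ᵇ_; _<ᵇ_; _≟_)
open import Data.Fin using (Fin; toℕ)
open import Data.Fin.Properties using (all?)
open import Data.List using (List; []; _∷_; _++_; map; filter; length; lookup; upTo)
open import Data.List.Membership.Propositional using (_∈_)
open import Data.List.Membership.DecPropositional _≟_ using (_∈?_)
open import Data.Product using (_×_; _,_)
open import Data.Bool using (if_then_else_)
open import Relation.Nullary using (¬_; Dec)
import Relation.Nullary.Decidable.Core as Dec
open import Relation.Nullary.Decidable using (_×-dec_; _→-dec_; ¬?)
open import Relation.Binary.PropositionalEquality using (_≡_)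

-- Permutations are lists of naturals π = π₁ ⋯ πₙ (entries 1..n).

range : ℕ → List ℕ
range n = map suc (upTo n)

IsPerm : ℕ → List ℕ → Set
IsPerm n π = (length π ≡ n) × (∀ (k : Fin n) → suc (toℕ k) ∈ π)

Avoids1-23 : List ℕ → Set
Avoids1-23 π = ∀ (i j k : Fin (length π)) → toℕ i < toℕ j → toℕ k ≡ suc (toℕ j) →
  ¬ ((lookup π i < lookup π j) × (lookup π j < lookup π k))

Avoids3-12 : List ℕ → Set
Avoids3-12 π = ∀ (i j k : Fin (length π)) → toℕ i < toℕ j → toℕ k ≡ suc (toℕ j) →
  ¬ ((lookup π j < lookup π k) × (lookup π k < lookup π i))

Avoids34-21 : List ℕ → Set
Avoids34-21 π = ∀ (i i' k k' : Fin (length π)) → toℕ i' ≡ suc (toℕ i) →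
  suc (toℕ i) < toℕ k → toℕ k' ≡ suc (toℕ k) →
  ¬ ((lookup π k' < lookup π k) × (lookup π k < lookup π i) × (lookup π i < lookup π i'))

C : ℕ → List ℕ → Set
C n π = IsPerm n π × Avoids1-23 π × Avoids3-12 π × Avoids34-21 π

C? : ∀ n π → Dec (C n π)
C? n π =
  (length π ≟ n ×-dec all? (λ k → suc (toℕ k) ∈? π))
  ×-dec all? (λ i → all? (λ j → all? (λ k →
          (toℕ i <? toℕ j) →-dec (toℕ k ≟ suc (toℕ j)) →-dec
          ¬? ((lookup π i <? lookup π j) ×-dec (lookup π j <? lookup π k)))))
  ×-dec all? (λ i → all? (λ j → all? (λ k →
          (toℕ i <? toℕ j) →-dec (toℕ k ≟ suc (toℕ j)) →-dec
          ¬? ((lookup π j <? lookup π k) ×-dec (lookup π k <? lookup π i)))))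
  ×-dec all? (λ i → all? (λ i' → all? (λ k → all? (λ k' →
          (toℕ i' ≟ suc (toℕ i)) →-dec (suc (toℕ i) <? toℕ k) →-dec
          (toℕ k' ≟ suc (toℕ k)) →-dec
          ¬? ((lookup π k' <? lookup π k) ×-dec (lookup π k <? lookup π i)
               ×-dec (lookup π i <? lookup π i'))))))

append : List ℕ → ℕ → List ℕ
append π j = map (λ x → if j ≤ᵇ x then suc x else x) π ++ (j ∷ [])

-- the children of π ∈ 𝒞ₙ: the permutations obtained by appending j ∈ {1,…,n+1}
-- that lie in 𝒞ₙ₊₁ (listed by increasing j; each j gives a distinct permutation)
children : ℕ → List ℕ → List (List ℕ)
children n π = filter (C? (suc n)) (map (append π) (range (suc n)))

-- s(π) = max{π_i : π_i < π_{i+1}}, and 0 if there is no ascent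
-- (for a permutation, "no ascent" means π = n(n-1)⋯21)
-- sFrom x ρ = max of ascent bottoms in x ∷ ρ (0 if none)
sFrom : ℕ → List ℕ → ℕ
sFrom x [] = 0
sFrom x (y ∷ ρ) = (if x <ᵇ y then x else 0) ⊔ sFrom y ρ

s : List ℕ → ℕ
s [] = 0
s (x ∷ ρ) = sFrom x ρ

-- last entry π_n (0 for the empty list, never used)
lastEntry : List ℕ → ℕ
lastEntry [] = 0
lastEntry (x ∷ []) = x
lastEntry (x ∷ y ∷ ρ) = lastEntry (y ∷ ρ)

Label : Set
Label = ℕ × ℕ × ℕ

label : ℕ → List ℕ → Label
label n π = s π , lastEntry π , n

fromTo : ℕ → ℕ → List ℕ
fromTo a b = map (λ i → a + i) (range (b ∸ a))

module Submission where

-- Let π ∈ 𝒞ₙ have last entry r = πₙ and s = s(π), and write π·j for π with j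
-- appended.  The relabelling x ↦ shift j x performed by `append` is strictly
-- increasing, so a pattern occurrence in π·j avoiding the new last entry is an
-- occurrence in π.  Hence membership of π·j in 𝒞ₙ₊₁ is decided by occurrences
-- ending at the new entry, and these are controlled by r and s:
--   * j ≤ r and s < r       ⇒ π·j is a child;
--   * r = 1 and j = n+1     ⇒ π·j is a child;
--   * 2 ≤ r < j             ⇒ 1 ⋯ r j is a 1-23;
--   * r = 1 and 2 ≤ j ≤ n   ⇒ n ⋯ 1 j is a 3-12;
--   * j ≤ r < s             ⇒ s s⁺ ⋯ r j is a 34-21 (s⁺ the entry after s).
-- So the children are π·j for j in an explicit sublist of 1, …, n+1, and
-- s(π·j) = max(shift j s, contribution of the new last step) gives the labels.

open import Defs
open import Data.Bool using (true; if_then_else_)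
open import Data.Bool.Properties using (T-≡; ¬-not)
open import Data.Empty using (⊥; ⊥-elim)
open import Data.Fin using (Fin; toℕ; fromℕ<) renaming (zero to fz; suc to fs)
import Data.Fin.Properties as Fin
open import Data.List using (List; []; _∷_; _++_; map; filter; length; lookup; applyUpTo)
open import Data.List.Properties
  using (length-++; length-map; filter-accept; filter-reject; filter-none; filter-++;
         map-applyUpTo; map-cong-local; map-∘; map-++)
open import Data.List.Membership.Propositional using (_∈_)
open import Data.List.Membership.Propositional.Properties using (∈-map⁺; ∈-++⁺ˡ; ∈-++⁺ʳ)
import Data.List.Relation.Unary.All as All
import Data.List.Relation.Unary.All.Properties as AllP
open import Data.List.Relation.Unary.Any using (here; there; index)
open import Data.List.Relation.Unary.Any.Properties using (lookup-index)
open import Data.List.Relation.Binary.Permutation.Propositional using (_↭_; ↭-reflexive)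
open import Data.Nat
open import Data.Nat.Properties
open import Data.Product using (_×_; _,_; proj₁; proj₂; Σ)
open import Data.Sum using (_⊎_; inj₁; inj₂)
open import Function.Bundles using (Equivalence)
open import Level using (0ℓ)
open import Relation.Binary.Definitions using (tri<; tri≈; tri>)
open import Relation.Binary.PropositionalEquality
open import Relation.Nullary using (¬_; yes; no; Dec)
open import Relation.Nullary.Decidable using (_×-dec_; _⊎-dec_)
open import Relation.Unary using (Pred; Decidable)

shift : ℕ → ℕ → ℕ
shift j x = if j ≤ᵇ x then suc x else x

shift-above : ∀ j x → j ≤ x → shift j x ≡ suc x
shift-above j x j≤x rewrite Equivalence.to T-≡ (≤⇒≤ᵇ j≤x) = refl

shift-below : ∀ j x → x < j → shift j x ≡ x
shift-below j x x<j
  rewrite ¬-not {j ≤ᵇ x} {true} (λ b → <⇒≱ x<j (≤ᵇ⇒≤ j x (Equivalence.from T-≡ b))) = refl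

shift-mono : ∀ j a b → a < b → shift j a < shift j b
shift-mono j a b a<b with j ≤? a | j ≤? b
... | yes j≤a | yes j≤b rewrite shift-above j a j≤a | shift-above j b j≤b = s≤s a<b
... | yes j≤a | no j≰b = ⊥-elim (j≰b (≤-trans j≤a (<⇒≤ a<b)))
... | no j≰a | yes j≤b rewrite shift-below j a (≰⇒> j≰a) | shift-above j b j≤b = m<n⇒m<1+n a<b
... | no j≰a | no j≰b rewrite shift-below j a (≰⇒> j≰a) | shift-below j b (≰⇒> j≰b) = a<b

shift-reflects : ∀ j a b → shift j a < shift j b → a < b
shift-reflects j a b sa<sb with <-cmp a b
... | tri< a<b _ _ = a<b
... | tri≈ _ refl _ = ⊥-elim (<-irrefl refl sa<sb)
... | tri> _ _ b<a = ⊥-elim (<-asym sa<sb (shift-mono j b a b<a))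

shift-mono-≤ : ∀ j a b → a ≤ b → shift j a ≤ shift j b
shift-mono-≤ j a b a≤b with m≤n⇒m<n∨m≡n a≤b
... | inj₁ a<b = <⇒≤ (shift-mono j a b a<b)
... | inj₂ refl = ≤-refl

-- Monotone maps commute with ⊔; needed because s is a maximum.
shift-⊔ : ∀ j a b → shift j (a ⊔ b) ≡ shift j a ⊔ shift j b
shift-⊔ j a b with ≤-total a b
... | inj₁ a≤b rewrite m≤n⇒m⊔n≡n a≤b | m≤n⇒m⊔n≡n (shift-mono-≤ j a b a≤b) = refl
... | inj₂ b≤a rewrite m≥n⇒m⊔n≡m b≤a | m≥n⇒m⊔n≡m (shift-mono-≤ j b a b≤a) = refl

-- Positional access: the i-th entry (from 0) of a list, 0 outside it.  Working
-- with ℕ positions avoids the Fin bookkeeping of `lookup`.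
at : List ℕ → ℕ → ℕ
at [] _ = 0
at (x ∷ xs) zero = x
at (x ∷ xs) (suc i) = at xs i

lookup≡at : ∀ xs (i : Fin (length xs)) → lookup xs i ≡ at xs (toℕ i)
lookup≡at (x ∷ xs) fz = refl
lookup≡at (x ∷ xs) (fs i) = lookup≡at xs i

lookup-fromℕ< : ∀ xs i (i<len : i < length xs) → lookup xs (fromℕ< i<len) ≡ at xs i
lookup-fromℕ< xs i i<len = trans (lookup≡at xs (fromℕ< i<len)) (cong (at xs) (Fin.toℕ-fromℕ< i<len))

at-++ˡ : ∀ xs ys i → i < length xs → at (xs ++ ys) i ≡ at xs i
at-++ˡ (x ∷ xs) ys zero _ = refl
at-++ˡ (x ∷ xs) ys (suc i) (s≤s i<len) = at-++ˡ xs ys i i<len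

at-++-length : ∀ xs j ys → at (xs ++ (j ∷ ys)) (length xs) ≡ j
at-++-length [] j ys = refl
at-++-length (x ∷ xs) j ys = at-++-length xs j ys

at-map : ∀ (g : ℕ → ℕ) xs i → i < length xs → at (map g xs) i ≡ g (at xs i)
at-map g (x ∷ xs) zero _ = refl
at-map g (x ∷ xs) (suc i) (s≤s i<len) = at-map g xs i i<len

∈⇒position : ∀ {x xs} → x ∈ xs → Σ ℕ λ i → i < length xs × at xs i ≡ x
∈⇒position (here refl) = 0 , s≤s z≤n , refl
∈⇒position (there x∈xs) with ∈⇒position x∈xs
... | i , i<len , eq = suc i , s≤s i<len , eq

at-∈ : ∀ xs i → i < length xs → at xs i ∈ xs
at-∈ (x ∷ xs) zero _ = here refl
at-∈ (x ∷ xs) (suc i) (s≤s i<len) = there (at-∈ xs i i<len)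

length-append : ∀ π j → length (append π j) ≡ suc (length π)
length-append π j =
  trans (length-++ (map (shift j) π)) (trans (cong (_+ 1) (length-map (shift j) π)) (+-comm (length π) 1))

at-append-old : ∀ π j i → i < length π → at (append π j) i ≡ shift j (at π i)
at-append-old π j i i<len =
  trans (at-++ˡ (map (shift j) π) (j ∷ []) i (subst (i <_) (sym (length-map (shift j) π)) i<len))
        (at-map (shift j) π i i<len)

at-append-new : ∀ π j → at (append π j) (length π) ≡ j
at-append-new π j =
  trans (cong (at (append π j)) (sym (length-map (shift j) π))) (at-++-length (map (shift j) π) j [])

-- The avoidance conditions with ℕ positions; the consecutive positions are
-- written as j, suc j instead of being separate Fin variables.
Avoids1-23′ : List ℕ → Set
Avoids1-23′ π = ∀ i j → i < j → suc j < length π →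
  at π i < at π j → at π j < at π (suc j) → ⊥

Avoids3-12′ : List ℕ → Set
Avoids3-12′ π = ∀ i j → i < j → suc j < length π →
  at π j < at π (suc j) → at π (suc j) < at π i → ⊥

Avoids34-21′ : List ℕ → Set
Avoids34-21′ π = ∀ i k → suc i < k → suc k < length π →
  at π (suc k) < at π k → at π k < at π i → at π i < at π (suc i) → ⊥

indexed1-23 : ∀ π → Avoids1-23 π → Avoids1-23′ π
indexed1-23 π av i j i<j sj<len a b =
  av (fromℕ< i<len) (fromℕ< j<len) (fromℕ< sj<len)
    (subst₂ _<_ (sym (Fin.toℕ-fromℕ< i<len)) (sym (Fin.toℕ-fromℕ< j<len)) i<j)
    (trans (Fin.toℕ-fromℕ< sj<len) (cong suc (sym (Fin.toℕ-fromℕ< j<len))))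
    (subst₂ _<_ (sym (lookup-fromℕ< π i i<len)) (sym (lookup-fromℕ< π j j<len)) a ,
     subst₂ _<_ (sym (lookup-fromℕ< π j j<len)) (sym (lookup-fromℕ< π (suc j) sj<len)) b)
  where
  j<len : j < length π
  j<len = <⇒≤ sj<len
  i<len : i < length π
  i<len = <-trans i<j j<len

unindexed1-23 : ∀ π → Avoids1-23′ π → Avoids1-23 π
unindexed1-23 π av i j k i<j k≡sj (a , b) =
  av (toℕ i) (toℕ j) i<j (subst (_< length π) k≡sj (Fin.toℕ<n k))
    (subst₂ _<_ (lookup≡at π i) (lookup≡at π j) a)
    (subst₂ _<_ (lookup≡at π j) (trans (lookup≡at π k) (cong (at π) k≡sj)) b)

indexed3-12 : ∀ π → Avoids3-12 π → Avoids3-12′ π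
indexed3-12 π av i j i<j sj<len a b =
  av (fromℕ< i<len) (fromℕ< j<len) (fromℕ< sj<len)
    (subst₂ _<_ (sym (Fin.toℕ-fromℕ< i<len)) (sym (Fin.toℕ-fromℕ< j<len)) i<j)
    (trans (Fin.toℕ-fromℕ< sj<len) (cong suc (sym (Fin.toℕ-fromℕ< j<len))))
    (subst₂ _<_ (sym (lookup-fromℕ< π j j<len)) (sym (lookup-fromℕ< π (suc j) sj<len)) a ,
     subst₂ _<_ (sym (lookup-fromℕ< π (suc j) sj<len)) (sym (lookup-fromℕ< π i i<len)) b)
  where
  j<len : j < length π
  j<len = <⇒≤ sj<len
  i<len : i < length π
  i<len = <-trans i<j j<len

unindexed3-12 : ∀ π → Avoids3-12′ π → Avoids3-12 π
unindexed3-12 π av i j k i<j k≡sj (a , b) =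
  av (toℕ i) (toℕ j) i<j (subst (_< length π) k≡sj (Fin.toℕ<n k))
    (subst₂ _<_ (lookup≡at π j) (trans (lookup≡at π k) (cong (at π) k≡sj)) a)
    (subst₂ _<_ (trans (lookup≡at π k) (cong (at π) k≡sj)) (lookup≡at π i) b)

indexed34-21 : ∀ π → Avoids34-21 π → Avoids34-21′ π
indexed34-21 π av i k si<k sk<len a b c =
  av (fromℕ< i<len) (fromℕ< si<len) (fromℕ< k<len) (fromℕ< sk<len)
    (trans (Fin.toℕ-fromℕ< si<len) (cong suc (sym (Fin.toℕ-fromℕ< i<len))))
    (subst₂ _<_ (cong suc (sym (Fin.toℕ-fromℕ< i<len))) (sym (Fin.toℕ-fromℕ< k<len)) si<k)
    (trans (Fin.toℕ-fromℕ< sk<len) (cong suc (sym (Fin.toℕ-fromℕ< k<len))))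
    (subst₂ _<_ (sym (lookup-fromℕ< π (suc k) sk<len)) (sym (lookup-fromℕ< π k k<len)) a ,
     subst₂ _<_ (sym (lookup-fromℕ< π k k<len)) (sym (lookup-fromℕ< π i i<len)) b ,
     subst₂ _<_ (sym (lookup-fromℕ< π i i<len)) (sym (lookup-fromℕ< π (suc i) si<len)) c)
  where
  k<len : k < length π
  k<len = <⇒≤ sk<len
  si<len : suc i < length π
  si<len = <-trans si<k k<len
  i<len : i < length π
  i<len = <⇒≤ si<len

unindexed34-21 : ∀ π → Avoids34-21′ π → Avoids34-21 π
unindexed34-21 π av i i' k k' i'≡si si<k k'≡sk (a , b , c) =
  av (toℕ i) (toℕ k) si<k (subst (_< length π) k'≡sk (Fin.toℕ<n k'))
    (subst₂ _<_ (trans (lookup≡at π k') (cong (at π) k'≡sk)) (lookup≡at π k) a)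
    (subst₂ _<_ (lookup≡at π k) (lookup≡at π i) b)
    (subst₂ _<_ (lookup≡at π i) (trans (lookup≡at π i') (cong (at π) i'≡si)) c)

-- Every entry of a permutation of {1,…,n} lies in {1,…,n}: otherwise x and
-- the n values 1,…,n would occupy n+1 distinct positions among n (pigeonhole).
perm-entry-bounds : ∀ n π → IsPerm n π → ∀ {x} → x ∈ π → 1 ≤ x × x ≤ n
perm-entry-bounds n π (len , has) {x} x∈π with (1 ≤? x) ×-dec (x ≤? n)
... | yes x-bounded = x-bounded
... | no x-unbounded = collision (Fin.pigeonhole (≤-reflexive (cong suc len)) position)
  where
  value : Fin (suc n) → ℕ
  value fz = x
  value (fs k) = suc (toℕ k)
  position : Fin (suc n) → Fin (length π)
  position fz = index x∈π
  position (fs k) = index (has k)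
  value-at : ∀ i → value i ≡ lookup π (position i)
  value-at fz = lookup-index x∈π
  value-at (fs k) = lookup-index (has k)
  same-value : ∀ {i i'} → position i ≡ position i' → value i ≡ value i'
  same-value {i} {i'} eq = trans (value-at i) (trans (cong (lookup π) eq) (sym (value-at i')))
  collision : (Σ (Fin (suc n)) λ i → Σ (Fin (suc n)) λ i' → toℕ i < toℕ i' × position i ≡ position i') →
              1 ≤ x × x ≤ n
  collision (fz , fs k , _ , same) =
    ⊥-elim (x-unbounded (subst (λ y → 1 ≤ y × y ≤ n) (sym (same-value same)) (s≤s z≤n , Fin.toℕ<n k)))
  collision (fs k , fs k' , k<k' , same) = ⊥-elim (<-irrefl (same-value same) k<k')

perm-at-bounds : ∀ n π → IsPerm n π → ∀ i → i < length π → 1 ≤ at π i × at π i ≤ n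
perm-at-bounds n π perm i i<len = perm-entry-bounds n π perm (at-∈ π i i<len)

perm-contains : ∀ n π → IsPerm n π → ∀ m → m < n → suc m ∈ π
perm-contains n π (_ , has) m m<n = subst (_∈ π) (cong suc (Fin.toℕ-fromℕ< m<n)) (has (fromℕ< m<n))

perm-position : ∀ n π → IsPerm n π → ∀ v → 1 ≤ v → v ≤ n → Σ ℕ λ i → i < length π × at π i ≡ v
perm-position n π perm (suc v) _ v<n = ∈⇒position (perm-contains n π perm v v<n)

-- Appending any 1 ≤ j ≤ n+1 to a permutation of {1,…,n} gives one of {1,…,n+1}:
-- m+1 is j itself, or the shift of m+1 (if m+1 < j) or of m (if m+1 > j).
append-contains : ∀ n π → IsPerm n π → ∀ j → 1 ≤ j → j ≤ suc n → ∀ m → m < suc n → suc m ∈ append π j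
append-contains n π perm j 1≤j j≤sn m m<sn with <-cmp (suc m) j
... | tri≈ _ sm≡j _ = ∈-++⁺ʳ (map (shift j) π) (here sm≡j)
... | tri< sm<j _ _ =
  ∈-++⁺ˡ (subst (_∈ map (shift j) π) (shift-below j (suc m) sm<j)
    (∈-map⁺ (shift j) (perm-contains n π perm m (s≤s⁻¹ (≤-trans sm<j j≤sn)))))
append-contains n π perm j 1≤j j≤sn (suc m) (s≤s m<n) | tri> _ _ (s≤s j≤m) =
  ∈-++⁺ˡ (subst (_∈ map (shift j) π) (shift-above j (suc m) j≤m)
    (∈-map⁺ (shift j) (perm-contains n π perm m m<n)))
append-contains n π perm j 1≤j j≤sn zero _ | tri> _ _ (s≤s j≤0) = ⊥-elim (<-irrefl refl (≤-trans 1≤j j≤0))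

append-isPerm : ∀ n π → IsPerm n π → ∀ j → 1 ≤ j → j ≤ suc n → IsPerm (suc n) (append π j)
append-isPerm n π perm j 1≤j j≤sn =
  trans (length-append π j) (cong suc (proj₁ perm)) ,
  λ k → append-contains n π perm j 1≤j j≤sn (toℕ k) (Fin.toℕ<n k)

ascent-if-< : ∀ x y → x < y → (if x <ᵇ y then x else 0) ≡ x
ascent-if-< x y x<y rewrite Equivalence.to T-≡ (<⇒<ᵇ x<y) = refl

ascent-if-≮ : ∀ x y → ¬ x < y → (if x <ᵇ y then x else 0) ≡ 0
ascent-if-≮ x y x≮y
  rewrite ¬-not {x <ᵇ y} {true} (λ b → x≮y (<ᵇ⇒< x y (Equivalence.from T-≡ b))) = refl

ascent≤sFrom : ∀ x ρ i → suc i < length (x ∷ ρ) → at (x ∷ ρ) i < at (x ∷ ρ) (suc i) → at (x ∷ ρ) i ≤ sFrom x ρ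
ascent≤sFrom x (y ∷ ρ) zero _ x<y rewrite ascent-if-< x y x<y = m≤m⊔n x (sFrom y ρ)
ascent≤sFrom x (y ∷ ρ) (suc i) (s≤s si<len) asc = ≤-trans (ascent≤sFrom y ρ i si<len asc) (m≤n⊔m _ (sFrom y ρ))

ascent≤s : ∀ π i → suc i < length π → at π i < at π (suc i) → at π i ≤ s π
ascent≤s (x ∷ ρ) = ascent≤sFrom x ρ

AscentBottom : List ℕ → ℕ → Set
AscentBottom π v = Σ ℕ λ i → suc i < length π × at π i ≡ v × at π i < at π (suc i)

sFrom-attained : ∀ x ρ → sFrom x ρ ≢ 0 → AscentBottom (x ∷ ρ) (sFrom x ρ)
sFrom-attained x [] s≢0 = ⊥-elim (s≢0 refl)
sFrom-attained x (y ∷ ρ) s≢0 with ⊔-sel (if x <ᵇ y then x else 0) (sFrom y ρ)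
... | inj₂ s≡rest with sFrom-attained y ρ (λ rest≡0 → s≢0 (trans s≡rest rest≡0))
...   | i , si<len , at≡ , asc = suc i , s≤s si<len , trans at≡ (sym s≡rest) , asc
sFrom-attained x (y ∷ ρ) s≢0 | inj₁ s≡first with x <? y
... | yes x<y = 0 , s≤s (s≤s z≤n) , trans (sym (ascent-if-< x y x<y)) (sym s≡first) , x<y
... | no x≮y = ⊥-elim (s≢0 (trans s≡first (ascent-if-≮ x y x≮y)))

s-attained : ∀ π → s π ≢ 0 → AscentBottom π (s π)
s-attained [] s≢0 = ⊥-elim (s≢0 refl)
s-attained (x ∷ ρ) = sFrom-attained x ρ

lastEntry-snoc : ∀ xs j → lastEntry (xs ++ j ∷ []) ≡ j
lastEntry-snoc [] j = refl
lastEntry-snoc (x ∷ []) j = refl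
lastEntry-snoc (x ∷ y ∷ zs) j = lastEntry-snoc (y ∷ zs) j

lastEntry-append : ∀ π j → lastEntry (append π j) ≡ j
lastEntry-append π j = lastEntry-snoc (map (shift j) π) j

lastEntry≡at : ∀ x ρ → lastEntry (x ∷ ρ) ≡ at (x ∷ ρ) (length ρ)
lastEntry≡at x [] = refl
lastEntry≡at x (y ∷ ρ) = lastEntry≡at y ρ

lastEntry-map : ∀ (f : ℕ → ℕ) x ρ → lastEntry (map f (x ∷ ρ)) ≡ f (lastEntry (x ∷ ρ))
lastEntry-map f x [] = refl
lastEntry-map f x (y ∷ ρ) = lastEntry-map f y ρ

sFrom-snoc : ∀ x ρ y → sFrom x (ρ ++ y ∷ []) ≡ sFrom x ρ ⊔ (if lastEntry (x ∷ ρ) <ᵇ y then lastEntry (x ∷ ρ) else 0)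
sFrom-snoc x [] y = ⊔-identityʳ _
sFrom-snoc x (z ∷ ρ) y rewrite sFrom-snoc z ρ y = sym (⊔-assoc (if x <ᵇ z then x else 0) (sFrom z ρ) _)

-- Shifting all entries shifts s (using shift j 0 = 0 for j ≥ 1).
sFrom-shift : ∀ j x ρ → 1 ≤ j → sFrom (shift j x) (map (shift j) ρ) ≡ shift j (sFrom x ρ)
sFrom-shift j x [] 1≤j = sym (shift-below j 0 1≤j)
sFrom-shift j x (y ∷ ρ) 1≤j rewrite sFrom-shift j y ρ 1≤j | shift-⊔ j (if x <ᵇ y then x else 0) (sFrom y ρ) with x <? y
... | yes x<y rewrite ascent-if-< x y x<y | ascent-if-< (shift j x) (shift j y) (shift-mono j x y x<y) = refl
... | no x≮y rewrite ascent-if-≮ x y x≮y | ascent-if-≮ (shift j x) (shift j y) (λ lt → x≮y (shift-reflects j x y lt))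
                   | shift-below j 0 1≤j = refl

s-append : ∀ π q j → length π ≡ suc q → 1 ≤ j →
  s (append π j) ≡ shift j (s π) ⊔ (if shift j (at π q) <ᵇ j then shift j (at π q) else 0)
s-append (x ∷ ρ) q j refl 1≤j
  rewrite sFrom-snoc (shift j x) (map (shift j) ρ) j | sFrom-shift j x ρ 1≤j
        | lastEntry-map (shift j) x ρ | lastEntry≡at x ρ = refl

label-append : ∀ n π j → label n (append π j) ≡ (s (append π j) , j , n)
label-append n π j = cong (λ r → s (append π j) , r , n) (lastEntry-append π j)

-- The local criterion for π·j, where π has length q+1 (so r = at π q).  Each
-- avoidance condition holds for π·j as soon as it holds for π and no
-- occurrence ends at the new last position q+1; conversely an occurrence
-- ending there refutes it.
module Appending (π : List ℕ) (q j : ℕ) (len≡ : length π ≡ suc q) where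

  πj : List ℕ
  πj = append π j

  len-πj : length πj ≡ suc (suc q)
  len-πj = trans (length-append π j) (cong suc len≡)

  old : ∀ i → i < suc q → at πj i ≡ shift j (at π i)
  old i i<sq = at-append-old π j i (subst (i <_) (sym len≡) i<sq)

  new : at πj (suc q) ≡ j
  new = subst (λ p → at πj p ≡ j) len≡ (at-append-new π j)

  last<len : suc q < length πj
  last<len = subst (suc q <_) (sym len-πj) ≤-refl

  pair-position : ∀ k → suc k < length πj → k < q ⊎ k ≡ q
  pair-position k sk<len = m≤n⇒m<n∨m≡n (s≤s⁻¹ (s≤s⁻¹ (subst (suc k <_) len-πj sk<len)))

  inside : ∀ {k} → k < q → suc k < length π
  inside k<q = subst (_ <_) (sym len≡) (s≤s k<q)

  -- Occurrences inside π are pulled back along shift j; those ending at the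
  -- new entry are excluded by the second hypothesis.
  extend1-23 : Avoids1-23′ π →
    (∀ i → i < q → shift j (at π i) < shift j (at π q) → shift j (at π q) < j → ⊥) → Avoids1-23′ πj
  extend1-23 av ends-new i k i<k sk<len a b with pair-position k sk<len
  ... | inj₁ k<q = av i k i<k (inside k<q)
        (shift-reflects j _ _ (subst₂ _<_ (old i (<-trans i<k (m<n⇒m<1+n k<q))) (old k (m<n⇒m<1+n k<q)) a))
        (shift-reflects j _ _ (subst₂ _<_ (old k (m<n⇒m<1+n k<q)) (old (suc k) (s≤s k<q)) b))
  ... | inj₂ refl = ends-new i i<k (subst₂ _<_ (old i (m<n⇒m<1+n i<k)) (old k ≤-refl) a)
        (subst₂ _<_ (old k ≤-refl) new b)

  extend3-12 : Avoids3-12′ π →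
    (∀ i → i < q → shift j (at π q) < j → j < shift j (at π i) → ⊥) → Avoids3-12′ πj
  extend3-12 av ends-new i k i<k sk<len a b with pair-position k sk<len
  ... | inj₁ k<q = av i k i<k (inside k<q)
        (shift-reflects j _ _ (subst₂ _<_ (old k (m<n⇒m<1+n k<q)) (old (suc k) (s≤s k<q)) a))
        (shift-reflects j _ _ (subst₂ _<_ (old (suc k) (s≤s k<q)) (old i (<-trans i<k (m<n⇒m<1+n k<q))) b))
  ... | inj₂ refl = ends-new i i<k (subst₂ _<_ (old k ≤-refl) new a)
        (subst₂ _<_ new (old i (m<n⇒m<1+n i<k)) b)

  extend34-21 : Avoids34-21′ π →
    (∀ i → suc i < q → j < shift j (at π q) → shift j (at π q) < shift j (at π i) →
       shift j (at π i) < shift j (at π (suc i)) → ⊥) → Avoids34-21′ πj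
  extend34-21 av ends-new i k si<k sk<len a b c with pair-position k sk<len
  ... | inj₁ k<q = av i k si<k (inside k<q)
        (shift-reflects j _ _ (subst₂ _<_ (old (suc k) (s≤s k<q)) (old k k<sq) a))
        (shift-reflects j _ _ (subst₂ _<_ (old k k<sq) (old i i<sq) b))
        (shift-reflects j _ _ (subst₂ _<_ (old i i<sq) (old (suc i) si<sq) c))
    where
    k<sq : k < suc q
    k<sq = m<n⇒m<1+n k<q
    si<sq : suc i < suc q
    si<sq = <-trans si<k k<sq
    i<sq : i < suc q
    i<sq = <⇒≤ si<sq
  ... | inj₂ refl = ends-new i si<k (subst₂ _<_ new (old k ≤-refl) a)
        (subst₂ _<_ (old k ≤-refl) (old i i<sq) b)
        (subst₂ _<_ (old i i<sq) (old (suc i) si<sq) c)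
    where
    si<sq : suc i < suc q
    si<sq = <-trans si<k ≤-refl
    i<sq : i < suc q
    i<sq = <⇒≤ si<sq

  ends1-23 : ∀ i → i < q → shift j (at π i) < shift j (at π q) → shift j (at π q) < j → ¬ Avoids1-23′ πj
  ends1-23 i i<q a b av = av i q i<q last<len
    (subst₂ _<_ (sym (old i (m<n⇒m<1+n i<q))) (sym (old q ≤-refl)) a)
    (subst₂ _<_ (sym (old q ≤-refl)) (sym new) b)

  ends3-12 : ∀ i → i < q → shift j (at π q) < j → j < shift j (at π i) → ¬ Avoids3-12′ πj
  ends3-12 i i<q a b av = av i q i<q last<len
    (subst₂ _<_ (sym (old q ≤-refl)) (sym new) a)
    (subst₂ _<_ (sym new) (sym (old i (m<n⇒m<1+n i<q))) b)

  ends34-21 : ∀ i → suc i < q → j < shift j (at π q) → shift j (at π q) < shift j (at π i) →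
    shift j (at π i) < shift j (at π (suc i)) → ¬ Avoids34-21′ πj
  ends34-21 i si<q a b c av = av i q si<q last<len
    (subst₂ _<_ (sym new) (sym (old q ≤-refl)) a)
    (subst₂ _<_ (sym (old q ≤-refl)) (sym (old i i<sq)) b)
    (subst₂ _<_ (sym (old i i<sq)) (sym (old (suc i) si<sq)) c)
    where
    si<sq : suc i < suc q
    si<sq = m<n⇒m<1+n si<q
    i<sq : i < suc q
    i<sq = <⇒≤ si<sq

size≡length : ∀ n π q → C n π → length π ≡ suc q → n ≡ suc q
size≡length n π q c len≡ = trans (sym (proj₁ (proj₁ c))) len≡

1≤size : ∀ n π q → C n π → length π ≡ suc q → 1 ≤ n
1≤size n π q c len≡ = subst (1 ≤_) (sym (size≡length n π q c len≡)) (s≤s z≤n)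

last<length : ∀ (π : List ℕ) q → length π ≡ suc q → q < length π
last<length π q len≡ = subst (q <_) (sym len≡) ≤-refl

before-last : ∀ (π : List ℕ) q p → length π ≡ suc q → p < length π → p ≢ q → p < q
before-last π q p len≡ p<len p≢q = ≤∧≢⇒< (s≤s⁻¹ (subst (p <_) len≡ p<len)) p≢q

-- If j ≤ r and s < r then π·j ∈ 𝒞ₙ₊₁: the new last step r⁺ j is a descent, so
-- no 1-23 or 3-12 ends there, and a 34-21 ending there would need an ascent
-- bottom above r, i.e. above s.
child-below-last : ∀ n π q j → C n π → length π ≡ suc q → 1 ≤ j → j ≤ at π q → s π < at π q →
  C (suc n) (append π j)
child-below-last n π q j (perm , av1 , av2 , av3) len≡ 1≤j j≤r s<r =
  append-isPerm n π perm j 1≤j (≤-trans j≤r (≤-trans r≤n (n≤1+n n))) ,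
  unindexed1-23 (append π j) (extend1-23 (indexed1-23 π av1) (λ _ _ _ r⁺<j → <-asym r⁺<j j<r⁺)) ,
  unindexed3-12 (append π j) (extend3-12 (indexed3-12 π av2) (λ _ _ r⁺<j _ → <-asym r⁺<j j<r⁺)) ,
  unindexed34-21 (append π j) (extend34-21 (indexed34-21 π av3) no-34-21)
  where
  open Appending π q j len≡
  r≤n : at π q ≤ n
  r≤n = proj₂ (perm-at-bounds n π perm q (last<length π q len≡))
  j<r⁺ : j < shift j (at π q)
  j<r⁺ = subst (j <_) (sym (shift-above j (at π q) j≤r)) (s≤s j≤r)
  no-34-21 : ∀ i → suc i < q → j < shift j (at π q) → shift j (at π q) < shift j (at π i) →
    shift j (at π i) < shift j (at π (suc i)) → ⊥
  no-34-21 i si<q _ r<πi πi<πsi =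
    <-irrefl refl (<-trans (≤-<-trans (ascent≤s π i (<-trans si<q (last<length π q len≡)) (shift-reflects j _ _ πi<πsi)) s<r)
                           (shift-reflects j _ _ r<πi))

-- If r = 1 then π·(n+1) ∈ 𝒞ₙ₊₁: the new last step 1 (n+1) is an ascent from
-- the minimum, which no entry lies below, and n+1 exceeds every earlier entry.
child-on-top : ∀ n π q → C n π → length π ≡ suc q → at π q ≡ 1 → C (suc n) (append π (suc n))
child-on-top n π q c@(perm , av1 , av2 , av3) len≡ r≡1 =
  append-isPerm n π perm (suc n) (s≤s z≤n) ≤-refl ,
  unindexed1-23 (append π (suc n)) (extend1-23 (indexed1-23 π av1) no-1-23) ,
  unindexed3-12 (append π (suc n)) (extend3-12 (indexed3-12 π av2) no-3-12) ,
  unindexed34-21 (append π (suc n)) (extend34-21 (indexed34-21 π av3) no-34-21)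
  where
  open Appending π q (suc n) len≡
  entry-bounds : ∀ i → i < q → 1 ≤ at π i × at π i ≤ n
  entry-bounds i i<q = perm-at-bounds n π perm i (<-trans i<q (last<length π q len≡))
  no-1-23 : ∀ i → i < q → shift (suc n) (at π i) < shift (suc n) (at π q) → shift (suc n) (at π q) < suc n → ⊥
  no-1-23 i i<q πi<r _ =
    <⇒≱ πi<r (shift-mono-≤ (suc n) _ _ (subst (_≤ at π i) (sym r≡1) (proj₁ (entry-bounds i i<q))))
  no-3-12 : ∀ i → i < q → shift (suc n) (at π q) < suc n → suc n < shift (suc n) (at π i) → ⊥
  no-3-12 i i<q _ top<πi =
    <⇒≱ top<πi (subst (_≤ suc n) (sym (shift-below (suc n) _ (s≤s πi≤n))) (≤-trans πi≤n (n≤1+n n)))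
    where
    πi≤n : at π i ≤ n
    πi≤n = proj₂ (entry-bounds i i<q)
  no-34-21 : ∀ i → suc i < q → suc n < shift (suc n) (at π q) → shift (suc n) (at π q) < shift (suc n) (at π i) →
    shift (suc n) (at π i) < shift (suc n) (at π (suc i)) → ⊥
  no-34-21 i _ top<r _ _ =
    <⇒≱ (subst (suc n <_) (trans (cong (shift (suc n)) r≡1) (shift-below (suc n) 1 (s≤s (1≤size n π q c len≡)))) top<r)
        (s≤s z≤n)

-- If 2 ≤ r < j then π·j ∉ 𝒞ₙ₊₁: the entry 1 precedes r, and 1 r j is a 1-23.
no-child-above-last : ∀ n π q j → C n π → length π ≡ suc q → 2 ≤ at π q → at π q < j → ¬ C (suc n) (append π j)
no-child-above-last n π q j c@(perm , _) len≡ 2≤r r<j (_ , av1 , _)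
  with perm-position n π perm 1 (s≤s z≤n) (1≤size n π q c len≡)
... | p , p<len , πp≡1 = ends1-23 p p<q
      (subst (λ v → shift j v < shift j (at π q)) (sym πp≡1) (shift-mono j 1 (at π q) 2≤r))
      (subst (_< j) (sym (shift-below j (at π q) r<j)) r<j) (indexed1-23 (append π j) av1)
  where
  open Appending π q j len≡
  p<q : p < q
  p<q = before-last π q p len≡ p<len λ { refl → <-irrefl (sym πp≡1) 2≤r }

-- If r = 1 and 2 ≤ j ≤ n then π·j ∉ 𝒞ₙ₊₁: the entry n precedes r, and
-- (n+1) 1 j is a 3-12 after relabelling.
no-child-inside : ∀ n π q j → C n π → length π ≡ suc q → at π q ≡ 1 → 2 ≤ j → j ≤ n → ¬ C (suc n) (append π j)
no-child-inside n π q j c@(perm , _) len≡ r≡1 2≤j j≤n (_ , _ , av2 , _)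
  with perm-position n π perm n (≤-trans (s≤s z≤n) (≤-trans 2≤j j≤n)) ≤-refl
... | p , p<len , πp≡n = ends3-12 p p<q
      (subst (_< j) (sym (trans (cong (shift j) r≡1) (shift-below j 1 2≤j))) 2≤j)
      (subst (j <_) (sym (trans (cong (shift j) πp≡n) (shift-above j n j≤n))) (s≤s j≤n))
      (indexed3-12 (append π j) av2)
  where
  open Appending π q j len≡
  p<q : p < q
  p<q = before-last π q p len≡ p<len λ { refl → <-irrefl (trans (sym r≡1) πp≡n) (≤-trans 2≤j j≤n) }

-- If j ≤ r < s then π·j ∉ 𝒞ₙ₊₁: the ascent s s⁺ precedes r, and
-- s s⁺ r⁺ j is a 34-21 after relabelling.
no-child-under-ascent : ∀ n π q j → C n π → length π ≡ suc q → 1 ≤ j → j ≤ at π q → at π q < s π →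
  ¬ C (suc n) (append π j)
no-child-under-ascent n π q j c len≡ 1≤j j≤r r<s (_ , _ , _ , av3)
  with s-attained π (λ s≡0 → <⇒≱ r<s (subst (_≤ at π q) (sym s≡0) z≤n))
... | i , si<len , πi≡s , asc = ends34-21 i si<q
      (subst (j <_) (sym (shift-above j (at π q) j≤r)) (s≤s j≤r))
      (shift-mono j _ _ (subst (at π q <_) (sym πi≡s) r<s))
      (shift-mono j _ _ asc) (indexed34-21 (append π j) av3)
  where
  open Appending π q j len≡
  si<q : suc i < q
  si<q = before-last π q (suc i) len≡ si<len λ { refl → <-asym asc (subst (at π (suc i) <_) (sym πi≡s) r<s) }

interval : ℕ → ℕ → List ℕ
interval a zero = []
interval a (suc m) = suc a ∷ interval (suc a) m

applyUpTo≡interval : ∀ (f : ℕ → ℕ) a m → (∀ i → f i ≡ a + suc i) → applyUpTo f m ≡ interval a m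
applyUpTo≡interval f a zero _ = refl
applyUpTo≡interval f a (suc m) f≡ =
  cong₂ _∷_ (trans (f≡ 0) (trans (+-suc a 0) (cong suc (+-identityʳ a))))
    (applyUpTo≡interval (λ i → f (suc i)) (suc a) m (λ i → trans (f≡ (suc i)) (+-suc a (suc i))))

range≡interval : ∀ m → range m ≡ interval 0 m
range≡interval m = trans (map-applyUpTo (λ x → x) suc m) (applyUpTo≡interval suc 0 m (λ _ → refl))

fromTo≡interval : ∀ a b → fromTo a b ≡ interval a (b ∸ a)
fromTo≡interval a b =
  trans (cong (map (a +_)) (map-applyUpTo (λ x → x) suc (b ∸ a)))
    (trans (map-applyUpTo suc (a +_) (b ∸ a)) (applyUpTo≡interval (λ i → a + suc i) a (b ∸ a) (λ _ → refl)))

∈interval : ∀ {x} a m → x ∈ interval a m → a < x × x ≤ a + m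
∈interval a (suc m) (here refl) = ≤-refl , subst (suc a ≤_) (sym (+-suc a m)) (s≤s (m≤m+n a m))
∈interval {x} a (suc m) (there x∈) with ∈interval (suc a) m x∈
... | a<x , x≤ = <-trans (n<1+n a) a<x , subst (x ≤_) (sym (+-suc a m)) x≤

interval-++ : ∀ a b c → interval a (b + c) ≡ interval a b ++ interval (a + b) c
interval-++ a zero c = cong (λ z → interval z c) (sym (+-identityʳ a))
interval-++ a (suc b) c =
  cong (suc a ∷_) (trans (interval-++ (suc a) b c) (cong (λ z → interval (suc a) b ++ interval z c) (sym (+-suc a b))))

interval-snoc : ∀ a m → interval a (suc m) ≡ interval a m ++ (suc (a + m) ∷ [])
interval-snoc a m = trans (cong (interval a) (+-comm 1 m)) (interval-++ a m 1)

∸-suc : ∀ r a → a < r → r ∸ a ≡ suc (r ∸ suc a)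
∸-suc (suc r) zero _ = refl
∸-suc (suc r) (suc a) (s≤s a<r) = ∸-suc r a a<r

filter-≤-interval : ∀ r a m → a ≤ r → r ≤ a + m → filter (_≤? r) (interval a m) ≡ interval a (r ∸ a)
filter-≤-interval r a zero a≤r r≤a+0
  rewrite ≤-antisym r≤a+0 (subst (_≤ r) (sym (+-identityʳ a)) a≤r) | +-identityʳ a | n∸n≡0 a = refl
filter-≤-interval r a (suc m) a≤r r≤a+sm with suc a ≤? r
... | yes a<r =
  trans (filter-accept (_≤? r) a<r)
    (trans (cong (suc a ∷_) (filter-≤-interval r (suc a) m a<r (subst (r ≤_) (+-suc a m) r≤a+sm)))
           (cong (interval a) (sym (∸-suc r a a<r))))
... | no a≮r =
  trans (filter-reject (_≤? r) a≮r)
    (trans (filter-none (_≤? r) (All.tabulate λ x∈ → <⇒≱ (≤-<-trans (≤-reflexive r≡a) (proj₁ (∈interval a (suc m) (there x∈))))))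
           (cong (interval a) (sym (trans (cong (_∸ a) r≡a) (n∸n≡0 a)))))
  where
  r≡a : r ≡ a
  r≡a = ≤-antisym (s≤s⁻¹ (≰⇒> a≮r)) a≤r

filter-map : ∀ {A B : Set} {P : Pred B 0ℓ} {Q : Pred A 0ℓ} (P? : Decidable P) (Q? : Decidable Q) (f : A → B) xs →
  (∀ x → x ∈ xs → (P (f x) → Q x) × (Q x → P (f x))) → filter P? (map f xs) ≡ map f (filter Q? xs)
filter-map P? Q? f [] _ = refl
filter-map P? Q? f (x ∷ xs) agree with Q? x
... | yes qx = trans (filter-accept P? (proj₂ (agree x (here refl)) qx))
                 (cong (f x ∷_) (filter-map P? Q? f xs (λ y y∈ → agree y (there y∈))))
... | no ¬qx = trans (filter-reject P? (λ px → ¬qx (proj₁ (agree x (here refl)) px)))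
                 (filter-map P? Q? f xs (λ y y∈ → agree y (there y∈)))

children≡filter : ∀ n π {Q : ℕ → Set} (Q? : ∀ j → Dec (Q j)) →
  (∀ j → j ∈ interval 0 (suc n) → (C (suc n) (append π j) → Q j) × (Q j → C (suc n) (append π j))) →
  children n π ≡ map (append π) (filter Q? (interval 0 (suc n)))
children≡filter n π Q? criterion =
  trans (cong (λ l → filter (C? (suc n)) (map (append π) l)) (range≡interval (suc n)))
    (filter-map (C? (suc n)) Q? (append π) (interval 0 (suc n)) criterion)

-- s(π) ≤ n for a permutation of {1,…,n}, since s(π) is 0 or an entry.
s≤size : ∀ n π → IsPerm n π → s π ≤ n
s≤size n π perm with s π ≟ 0
... | yes s≡0 = subst (_≤ n) (sym s≡0) z≤n
... | no s≢0 with s-attained π s≢0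
...   | i , si<len , πi≡s , _ = subst (_≤ n) πi≡s (proj₂ (perm-at-bounds n π perm i (<⇒≤ si<len)))

children-s<r : ∀ n π q → C n π → length π ≡ suc q → s π < at π q → at π q ≢ 1 →
  children n π ≡ map (append π) (interval 0 (at π q))
children-s<r n π q c len≡ s<r r≢1 =
  trans (children≡filter n π (_≤? at π q) criterion)
    (cong (map (append π)) (filter-≤-interval (at π q) 0 (suc n) z≤n (≤-trans r≤n (n≤1+n n))))
  where
  r≤n : at π q ≤ n
  r≤n = proj₂ (perm-at-bounds n π (proj₁ c) q (last<length π q len≡))
  2≤r : 2 ≤ at π q
  2≤r = ≤∧≢⇒< (≤-trans (s≤s z≤n) s<r) (λ 1≡r → r≢1 (sym 1≡r))
  criterion : ∀ j → j ∈ interval 0 (suc n) →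
    (C (suc n) (append π j) → j ≤ at π q) × (j ≤ at π q → C (suc n) (append π j))
  criterion j j∈ =
    (λ child → ≮⇒≥ (λ r<j → no-child-above-last n π q j c len≡ 2≤r r<j child)) ,
    (λ j≤r → child-below-last n π q j c len≡ (proj₁ (∈interval 0 (suc n) j∈)) j≤r s<r)

-- … and for 1 ≤ j ≤ r the new last step of π·j is a descent, so s(π·j) = shift j s.
label-child-below-last : ∀ n π q j → length π ≡ suc q → 1 ≤ j → j ≤ at π q →
  label (suc n) (append π j) ≡ (shift j (s π) , j , suc n)
label-child-below-last n π q j len≡ 1≤j j≤r =
  trans (label-append (suc n) π j) (cong (λ v → v , j , suc n) s-child)
  where
  open ≡-Reasoning
  descent : ¬ shift j (at π q) < j
  descent r⁺<j = <⇒≱ r⁺<j (subst (j ≤_) (sym (shift-above j _ j≤r)) (≤-trans j≤r (n≤1+n _)))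
  s-child : s (append π j) ≡ shift j (s π)
  s-child = begin
    s (append π j)
      ≡⟨ s-append π q j len≡ 1≤j ⟩
    shift j (s π) ⊔ (if shift j (at π q) <ᵇ j then shift j (at π q) else 0)
      ≡⟨ cong (shift j (s π) ⊔_) (ascent-if-≮ (shift j (at π q)) j descent) ⟩
    shift j (s π) ⊔ 0
      ≡⟨ ⊔-identityʳ _ ⟩
    shift j (s π) ∎

-- Hence the labels: (s+1, j) for j ≤ s, where shift j s = s+1, and (s, j) for s < j ≤ r.
labels-s<r : ∀ n π q r → C n π → length π ≡ suc q → at π q ≡ r → s π < r → r ≢ 1 →
  map (label (suc n)) (children n π) ≡
    map (λ i → (suc (s π) , i , suc n)) (range (s π)) ++ map (λ i → (s π , i , suc n)) (fromTo (s π) r)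
labels-s<r n π q r c len≡ refl s<r r≢1 = begin
  map (label (suc n)) (children n π)
    ≡⟨ cong (map (label (suc n))) (children-s<r n π q c len≡ s<r r≢1) ⟩
  map (label (suc n)) (map (append π) (interval 0 r))
    ≡⟨ sym (map-∘ (interval 0 r)) ⟩
  map (λ j → label (suc n) (append π j)) (interval 0 r)
    ≡⟨ map-cong-local (All.tabulate λ {j} j∈ →
         label-child-below-last n π q j len≡ (proj₁ (∈interval 0 r j∈)) (proj₂ (∈interval 0 r j∈))) ⟩
  map child-label (interval 0 r)
    ≡⟨ cong (map child-label) (trans (cong (interval 0) (sym (m+[n∸m]≡n (<⇒≤ s<r)))) (interval-++ 0 (s π) (r ∸ s π))) ⟩
  map child-label (interval 0 (s π) ++ interval (s π) (r ∸ s π))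
    ≡⟨ map-++ child-label (interval 0 (s π)) _ ⟩
  map child-label (interval 0 (s π)) ++ map child-label (interval (s π) (r ∸ s π))
    ≡⟨ cong₂ _++_
         (map-cong-local (All.tabulate λ {j} j∈ →
            cong (λ v → v , j , suc n) (shift-above j (s π) (proj₂ (∈interval 0 (s π) j∈)))))
         (map-cong-local (All.tabulate λ {j} j∈ →
            cong (λ v → v , j , suc n) (shift-below j (s π) (proj₁ (∈interval (s π) (r ∸ s π) j∈))))) ⟩
  map (λ i → (suc (s π) , i , suc n)) (interval 0 (s π)) ++ map (λ i → (s π , i , suc n)) (interval (s π) (r ∸ s π))
    ≡⟨ sym (cong₂ _++_ (cong (map (λ i → (suc (s π) , i , suc n))) (range≡interval (s π)))
                       (cong (map (λ i → (s π , i , suc n))) (fromTo≡interval (s π) r))) ⟩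
  map (λ i → (suc (s π) , i , suc n)) (range (s π)) ++ map (λ i → (s π , i , suc n)) (fromTo (s π) r) ∎
  where
  open ≡-Reasoning
  child-label : ℕ → Label
  child-label j = shift j (s π) , j , suc n

children-when-r≡1 : ∀ n π q j → C n π → length π ≡ suc q → at π q ≡ 1 → j ∈ interval 0 (suc n) →
  C (suc n) (append π j) → j ≡ 1 ⊎ j ≡ suc n
children-when-r≡1 n π q j c len≡ r≡1 j∈ child with j ≟ 1 | j ≟ suc n
... | yes j≡1 | _ = inj₁ j≡1
... | no _ | yes j≡sn = inj₂ j≡sn
... | no j≢1 | no j≢sn = ⊥-elim (no-child-inside n π q j c len≡ r≡1 2≤j j≤n child)
  where
  2≤j : 2 ≤ j
  2≤j = ≤∧≢⇒< (proj₁ (∈interval 0 (suc n) j∈)) (λ 1≡j → j≢1 (sym 1≡j))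
  j≤n : j ≤ n
  j≤n = s≤s⁻¹ (≤∧≢⇒< (proj₂ (∈interval 0 (suc n) j∈)) j≢sn)

-- When r = 1 the top child π·(n+1) gains the ascent 1 (n+1), so s(π·(n+1)) = max(s, 1).
label-top-child : ∀ n π q → C n π → length π ≡ suc q → at π q ≡ 1 →
  label (suc n) (append π (suc n)) ≡ (s π ⊔ 1 , suc n , suc n)
label-top-child n π q c len≡ r≡1
  rewrite label-append (suc n) π (suc n) | s-append π q (suc n) len≡ (s≤s z≤n) | r≡1
        | shift-below (suc n) (s π) (s≤s (s≤size n π (proj₁ c)))
        | shift-below (suc n) 1 (s≤s (1≤size n π q c len≡)) | ascent-if-< 1 (suc n) (s≤s (1≤size n π q c len≡)) = refl

filter-endpoints : ∀ m → filter (λ j → (j ≟ 1) ⊎-dec (j ≟ suc (suc m))) (interval 0 (suc (suc m))) ≡ 1 ∷ suc (suc m) ∷ []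
filter-endpoints m =
  trans (filter-accept endpoint? {x = 1} {xs = interval 1 (suc m)} (inj₁ refl)) (cong (1 ∷_)
    (trans (cong (filter endpoint?) (interval-snoc 1 m))
      (trans (filter-++ endpoint? (interval 1 m) (suc (suc m) ∷ []))
        (cong₂ _++_ (filter-none endpoint? (All.tabulate λ x∈ → interior (∈interval 1 m x∈)))
                    (filter-accept endpoint? {x = suc (suc m)} {xs = []} (inj₂ refl))))))
  where
  endpoint? : ∀ j → Dec ((j ≡ 1) ⊎ (j ≡ suc (suc m)))
  endpoint? j = (j ≟ 1) ⊎-dec (j ≟ suc (suc m))
  interior : ∀ {x} → 1 < x × x ≤ suc m → ¬ ((x ≡ 1) ⊎ (x ≡ suc (suc m)))
  interior (1<x , _) (inj₁ x≡1) = <-irrefl (sym x≡1) 1<x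
  interior (_ , x≤sm) (inj₂ x≡ssm) = <-irrefl x≡ssm (s≤s x≤sm)

filter-top : ∀ n → filter (_≟ suc n) (interval 0 (suc n)) ≡ suc n ∷ []
filter-top n =
  trans (cong (filter (_≟ suc n)) (interval-snoc 0 n))
    (trans (filter-++ (_≟ suc n) (interval 0 n) (suc n ∷ []))
      (cong₂ _++_ (filter-none (_≟ suc n) (All.tabulate λ x∈ x≡sn → <-irrefl x≡sn (s≤s (proj₂ (∈interval 0 n x∈)))))
                  (filter-accept (_≟ suc n) {x = suc n} {xs = []} refl)))

labels-s≡0 : ∀ n π q r → C n π → length π ≡ suc q → at π q ≡ r → s π ≡ 0 → r ≡ 1 →
  map (label (suc n)) (children n π) ≡ ((0 , 1 , suc n) ∷ (1 , suc n , suc n) ∷ [])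
labels-s≡0 n π q r c len≡ refl s≡0 r≡1 with size≡length n π q c len≡
... | refl = begin
  map (label (suc n)) (children n π)
    ≡⟨ cong (map (label (suc n))) (children≡filter n π endpoint? criterion) ⟩
  map (label (suc n)) (map (append π) (filter endpoint? (interval 0 (suc n))))
    ≡⟨ cong (λ l → map (label (suc n)) (map (append π) l)) (filter-endpoints q) ⟩
  label (suc n) (append π 1) ∷ label (suc n) (append π (suc n)) ∷ []
    ≡⟨ cong₂ (λ a b → a ∷ b ∷ []) label-bottom (trans (label-top-child n π q c len≡ r≡1) (cong (λ v → v ⊔ 1 , suc n , suc n) s≡0)) ⟩
  (0 , 1 , suc n) ∷ (1 , suc n , suc n) ∷ [] ∎
  where
  open ≡-Reasoning
  endpoint? : ∀ j → Dec ((j ≡ 1) ⊎ (j ≡ suc n))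
  endpoint? j = (j ≟ 1) ⊎-dec (j ≟ suc n)
  criterion : ∀ j → j ∈ interval 0 (suc n) →
    (C (suc n) (append π j) → (j ≡ 1) ⊎ (j ≡ suc n)) × ((j ≡ 1) ⊎ (j ≡ suc n) → C (suc n) (append π j))
  criterion j j∈ = children-when-r≡1 n π q j c len≡ r≡1 j∈ , λ
    { (inj₁ refl) → child-below-last n π q 1 c len≡ ≤-refl (≤-reflexive (sym r≡1)) (subst₂ _<_ (sym s≡0) (sym r≡1) (s≤s z≤n))
    ; (inj₂ refl) → child-on-top n π q c len≡ r≡1 }
  -- appending 1 below the final 1 creates no ascent
  label-bottom : label (suc n) (append π 1) ≡ (0 , 1 , suc n)
  label-bottom rewrite label-append (suc n) π 1 | s-append π q 1 len≡ (s≤s z≤n) | s≡0 | r≡1 = refl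

-- Case r = 1 < s: π·1 would create the 34-21 s s⁺ 2 1, so π·(n+1) is the only child.
labels-r≡1<s : ∀ n π q r → C n π → length π ≡ suc q → at π q ≡ r → r < s π → r ≡ 1 →
  map (label (suc n)) (children n π) ≡ ((s π , suc n , suc n) ∷ [])
labels-r≡1<s n π q r c len≡ refl r<s r≡1 = begin
  map (label (suc n)) (children n π)
    ≡⟨ cong (map (label (suc n))) (children≡filter n π (_≟ suc n) criterion) ⟩
  map (label (suc n)) (map (append π) (filter (_≟ suc n) (interval 0 (suc n))))
    ≡⟨ cong (λ l → map (label (suc n)) (map (append π) l)) (filter-top n) ⟩
  label (suc n) (append π (suc n)) ∷ []
    ≡⟨ cong (_∷ []) (trans (label-top-child n π q c len≡ r≡1)
                           (cong (λ v → v , suc n , suc n) (m≥n⇒m⊔n≡m (≤-trans (s≤s z≤n) r<s)))) ⟩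
  (s π , suc n , suc n) ∷ [] ∎
  where
  open ≡-Reasoning
  criterion : ∀ j → j ∈ interval 0 (suc n) → (C (suc n) (append π j) → j ≡ suc n) × (j ≡ suc n → C (suc n) (append π j))
  criterion j j∈ = only-top , λ { refl → child-on-top n π q c len≡ r≡1 }
    where
    only-top : C (suc n) (append π j) → j ≡ suc n
    only-top child with children-when-r≡1 n π q j c len≡ r≡1 j∈ child
    ... | inj₂ j≡sn = j≡sn
    ... | inj₁ refl = ⊥-elim (no-child-under-ascent n π q 1 c len≡ ≤-refl (≤-reflexive (sym r≡1)) r<s child)

-- Case 1 < r < s: every j ≤ r creates a 34-21 and every j > r a 1-23.
no-children : ∀ n π q r → C n π → length π ≡ suc q → at π q ≡ r → 1 < r → r < s π → children n π ≡ []
no-children n π q r c len≡ refl 1<r r<s =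
  trans (cong (λ l → filter (C? (suc n)) (map (append π) l)) (range≡interval (suc n)))
    (filter-none (C? (suc n)) (AllP.map⁺ (All.tabulate λ {j} j∈ → not-child j j∈)))
  where
  not-child : ∀ j → j ∈ interval 0 (suc n) → ¬ C (suc n) (append π j)
  not-child j j∈ with j ≤? at π q
  ... | yes j≤r = no-child-under-ascent n π q j c len≡ (proj₁ (∈interval 0 (suc n) j∈)) j≤r r<s
  ... | no j≰r = no-child-above-last n π q j c len≡ 1<r (≰⇒> j≰r)

-- The four cases of the lemma, phrased with the last entry r = lastEntry π;
-- the empty permutation satisfies none of the case hypotheses.
case-s<r : ∀ n π → C n π → s π < lastEntry π → lastEntry π ≢ 1 →
  map (label (suc n)) (children n π)
    ↭ (map (λ i → (suc (s π) , i , suc n)) (range (s π)) ++ map (λ i → (s π , i , suc n)) (fromTo (s π) (lastEntry π)))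
case-s<r n [] c ()
case-s<r n (x ∷ ρ) c s<r r≢1 =
  ↭-reflexive (labels-s<r n (x ∷ ρ) (length ρ) (lastEntry (x ∷ ρ)) c refl (sym (lastEntry≡at x ρ)) s<r r≢1)

case-s≡0 : ∀ n π → C n π → s π ≡ 0 → lastEntry π ≡ 1 →
  map (label (suc n)) (children n π) ↭ ((0 , 1 , suc n) ∷ (1 , suc n , suc n) ∷ [])
case-s≡0 n [] c _ ()
case-s≡0 n (x ∷ ρ) c s≡0 r≡1 =
  ↭-reflexive (labels-s≡0 n (x ∷ ρ) (length ρ) (lastEntry (x ∷ ρ)) c refl (sym (lastEntry≡at x ρ)) s≡0 r≡1)

case-r≡1<s : ∀ n π → C n π → lastEntry π < s π → lastEntry π ≡ 1 →
  map (label (suc n)) (children n π) ↭ ((s π , suc n , suc n) ∷ [])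
case-r≡1<s n [] c ()
case-r≡1<s n (x ∷ ρ) c r<s r≡1 =
  ↭-reflexive (labels-r≡1<s n (x ∷ ρ) (length ρ) (lastEntry (x ∷ ρ)) c refl (sym (lastEntry≡at x ρ)) r<s r≡1)

case-1<r<s : ∀ n π → C n π → 1 < lastEntry π → lastEntry π < s π → children n π ≡ []
case-1<r<s n [] c ()
case-1<r<s n (x ∷ ρ) c 1<r r<s =
  no-children n (x ∷ ρ) (length ρ) (lastEntry (x ∷ ρ)) c refl (sym (lastEntry≡at x ρ)) 1<r r<s

-- The root 1 ∈ 𝒞₁: a one-entry list has no two distinct positions.
root-in-C : C 1 (1 ∷ [])
root-in-C = (refl , λ { fz → here refl }) , (λ { fz fz _ () }) , (λ { fz fz _ () }) , (λ { fz fz _ _ () })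

lemma4p1 : (C 1 (1 ∷ []) × label 1 (1 ∷ []) ≡ (0 , 1 , 1))
    × (∀ (n : ℕ) (π : List ℕ) → C n π →
        ((s π < lastEntry π) → lastEntry π ≢ 1 →
          map (label (suc n)) (children n π)
            ↭ (map (λ i → (suc (s π) , i , suc n)) (range (s π))
               ++ map (λ i → (s π , i , suc n)) (fromTo (s π) (lastEntry π))))
      × ((s π ≡ 0) → lastEntry π ≡ 1 →
          map (label (suc n)) (children n π)
            ↭ ((0 , 1 , suc n) ∷ (1 , suc n , suc n) ∷ []))
      × ((lastEntry π < s π) → lastEntry π ≡ 1 →
          map (label (suc n)) (children n π) ↭ ((s π , suc n , suc n) ∷ []))
      × ((1 < lastEntry π) → (lastEntry π < s π) →
          children n π ≡ []))
lemma4p1 = (root-in-C , refl) , λ n π c → case-s<r n π c , case-s≡0 n π c , case-r≡1<s n π c , case-1<r<s n π c
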